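{- Let $G_1\le G_2$ be permutation groups on the same finite set, and let $a$ be a positive integer with $F_{G_1}(-a)=0$. Then $F_{G_2}(-a)=0$.
   Context: $F_G(x)=\sum_{g\in G}x^{c(g)}$, where $c(g)$ is the number of cycles of $g$ (including fixed points). -}

module Defs where

open import Data.Nat as ℕ using (ℕ; zero; suc; _⊓_)
open import Data.Integer as ℤ using (ℤ)
open import Data.Fin using (Fin; toℕ)
open import Data.Vec using (Vec; lookup; tabulate; allFin)
open import Data.List as List using (List; length; filter; map; foldr; upTo)
open import Data.List.Membership.Propositional using (_∈_)
open import Data.List.Relation.Unary.Unique.Propositional using (Unique)
open import Data.Product using (Σ; _×_)
open import Relation.Binary.PropositionalEquality using (_≡_)

-- A map Fin n → Fin n, stored in one-line notation: lookup g i = g(i).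
Map : ℕ → Set
Map n = Vec (Fin n) n

_∘ₚ_ : ∀ {n} → Map n → Map n → Map n
g ∘ₚ h = tabulate (λ i → lookup g (lookup h i))

idₚ : ∀ {n} → Map n
idₚ {n} = allFin n

iter : ∀ {n} → Map n → ℕ → Fin n → Fin n
iter g zero    i = i
iter g (suc k) i = lookup g (iter g k i)

-- smallest point (as a natural number) of the cycle of g through i;
-- the cycle through i is { g^k(i) : k < n } since every cycle has length ≤ n.
orbitMin : ∀ {n} → Map n → Fin n → ℕ
orbitMin {n} g i = foldr (λ k m → toℕ (iter g k i) ⊓ m) (toℕ i) (upTo n)

-- c(g): number of cycles of g (fixed points included), counted as the number
-- of points that are the smallest element of their own cycle.
cycles : ∀ {n} → Map n → ℕ
cycles {n} g = length (filter (λ i → toℕ i ℕ.≟ orbitMin g i) (List.allFin n))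

record PermGroup (n : ℕ) : Set where
  field
    elems  : List (Map n)
    unique : Unique elems
    bij    : ∀ {g} → g ∈ elems → ∀ i j → lookup g i ≡ lookup g j → i ≡ j
    id∈    : idₚ ∈ elems
    comp∈  : ∀ {g h} → g ∈ elems → h ∈ elems → (g ∘ₚ h) ∈ elems
    inv∈   : ∀ {g} → g ∈ elems → Σ (Map n) (λ h → h ∈ elems × (g ∘ₚ h) ≡ idₚ)

open PermGroup public

_≤G_ : ∀ {n} → PermGroup n → PermGroup n → Set
G₁ ≤G G₂ = ∀ {g} → g ∈ elems G₁ → g ∈ elems G₂

F : ∀ {n} → PermGroup n → ℤ → ℤ
F G x = foldr ℤ._+_ ℤ.0ℤ (map (λ g → x ℤ.^ cycles g) (elems G))

-- A permutation g fixes exactly a^c(g) of the a-colourings of the points (those constant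
-- on its cycles), and (−1)^c(g) = (−1)^c(id) · sgn g. Exchanging the order of summation,
--   F_G(−a) = (−1)^c(id) · Σ_f Σ_{g ∈ G_f} sgn g,
-- where f runs over colourings and G_f is the stabiliser of f. The inner sum vanishes when G_f contains an odd
-- permutation h (multiplication by h is a sign-reversing bijection of G_f), and equals |G_f| > 0 otherwise.
-- So F_G(−a) = 0 exactly when every stabiliser G_f contains an odd permutation, and this passes from G₁ to any
-- G₂ ⊇ G₁ since (G₂)_f ⊇ (G₁)_f. That the sign is multiplicative follows from the fact that composing with a
-- transposition (u v) merges the cycles of u and v when they differ, and splits their common cycle otherwise.

module Submission where

open import Defs

open import Algebra.Bundles using (CommutativeMonoid)
open import Data.Bool using (if_then_else_)
open import Data.Empty using (⊥-elim)
open import Data.Fin as Fin using (Fin; toℕ)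
open import Data.Fin.Permutation.Components using (transpose; transpose-inverse)
open import Data.Fin.Properties as Fin using (toℕ-injective; toℕ<n; pigeonhole; _≟_; all?; ¬∀⟶∃¬)
open import Data.Integer as ℤ using (ℤ; +_; -_; +[1+_]; -[1+_]; 0ℤ; 1ℤ; -1ℤ; _^_)
open import Data.Integer.Properties as ℤ using (-1*i≡-i; neg-involutive)
open import Data.List as List using (List; []; _∷_; [_]; _++_; _∷ʳ_; foldr; upTo; filter; length; map; concatMap)
open import Data.List.Membership.Propositional using (_∈_; find; lose)
open import Data.List.Membership.Propositional.Properties using (∈-upTo⁺; ∈-allFin; ∈-map⁺; ∈-map⁻)
open import Data.List.Membership.Propositional.Properties.WithK using (unique∧set⇒bag)
open import Data.List.Properties
  using (filter-++; length-++; filter-≐; filter-all; filter-none; filter-some; length-tabulate; map-cong-local; map-∘)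

open import Data.List.Relation.Binary.BagAndSetEquality using (∼bag⇒↭)
open import Data.List.Relation.Binary.Permutation.Propositional using (_↭_; ↭-sym; ↭⇒↭ₛ)
import Data.List.Relation.Binary.Permutation.Propositional.Properties as ↭
open import Data.List.Relation.Binary.Permutation.Setoid.Properties using (foldr-commMonoid)
open import Data.List.Relation.Binary.Subset.Propositional.Properties using (Any-resp-⊆)
open import Data.List.Relation.Unary.All as All using (All; []; _∷_)
import Data.List.Relation.Unary.All.Properties as All
open import Data.List.Relation.Unary.AllPairs using (_∷_)
open import Data.List.Relation.Unary.Any using (Any; here; there; any?)
open import Data.List.Relation.Unary.Unique.Propositional using (Unique)
import Data.List.Relation.Unary.Unique.Propositional.Properties as Unique
open import Data.Nat as ℕ using (ℕ; zero; suc; _+_; _*_; _∸_; _≤_; _<_; z≤n; s≤s; _⊓_)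
open import Data.Nat.DivMod using (_%_; _/_; m≡m%n+[m/n]*n; m%n<n)
open import Data.Nat.Induction using (<-wellFounded)
open import Data.Nat.ListAction using (sum)
open import Data.Nat.Properties as ℕ
  using (≤-refl; ≤-trans; ≤-antisym; <⇒≤; <-≤-trans; n<1+n; m⊓n≤m; m⊓n≤n; ⊓-sel; m≤m*n)

open import Data.Product using (Σ; ∃; _×_; _,_)
open import Data.Sum as Sum using (_⊎_; inj₁; inj₂)
open import Data.Vec using (lookup; tabulate)
open import Data.Vec.Properties using (lookup∘tabulate; tabulate∘lookup; tabulate-cong)
open import Function using (case_of_; _∘_)
open import Function.Bundles using (mk⇔)
open import Induction.WellFounded using (Acc; acc)
open import Relation.Binary using (tri<; tri≈; tri>)
open import Relation.Binary.PropositionalEquality hiding ([_])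
open import Relation.Nullary using (¬_; Dec; yes; no; ¬?; does)
open import Relation.Nullary.Decidable using (_×-dec_; _→-dec_)
open import Relation.Unary using (Decidable; _⊆_; _≐_)

open import Algebra.Properties.CommutativeSemigroup ℤ.+-commutativeSemigroup
  using () renaming (interchange to +-interchange)

open import Algebra.Properties.CommutativeSemigroup ℤ.*-commutativeSemigroup
  using () renaming (interchange to *-interchange)

Least : (ℕ → Set) → ℕ → Set
Least P l = P l × (∀ l′ → l′ < l → ¬ P l′)

module _ {P : ℕ → Set} (P? : ∀ k → Dec (P k)) where

  leastBelow : ∀ b → (∀ l → l < b → ¬ P l) ⊎ ∃ (Least P)
  leastBelow zero    = inj₁ λ _ ()
  leastBelow (suc b) with leastBelow b
  ... | inj₂ least = inj₂ least
  ... | inj₁ none with P? b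
  ...   | yes Pb = inj₂ (b , Pb , none)
  ...   | no ¬Pb = inj₁ λ l l<1+b → case ℕ.m<1+n⇒m<n∨m≡n l<1+b of λ
          { (inj₁ l<b)  → none l l<b
          ; (inj₂ refl) → ¬Pb }

  leastWitness : ∀ {k} → P k → ∃ (Least P)
  leastWitness {k} Pk with leastBelow (suc k)
  ... | inj₁ none  = ⊥-elim (none k (n<1+n k) Pk)
  ... | inj₂ least = least

module _ (f : ℕ → ℕ) where

  foldr-⊓-≤-init : ∀ b ks → foldr (λ k m → f k ⊓ m) b ks ≤ b
  foldr-⊓-≤-init b []       = ≤-refl
  foldr-⊓-≤-init b (k ∷ ks) = ≤-trans (m⊓n≤n _ _) (foldr-⊓-≤-init b ks)

  foldr-⊓-≤ : ∀ b {k} ks → k ∈ ks → foldr (λ k m → f k ⊓ m) b ks ≤ f k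
  foldr-⊓-≤ b (k ∷ ks) (here refl)  = m⊓n≤m _ _
  foldr-⊓-≤ b (_ ∷ ks) (there k∈ks) = ≤-trans (m⊓n≤n _ _) (foldr-⊓-≤ b ks k∈ks)

  foldr-⊓-sel : ∀ ks → ∃ λ k → foldr (λ k m → f k ⊓ m) (f 0) ks ≡ f k
  foldr-⊓-sel []       = 0 , refl
  foldr-⊓-sel (k ∷ ks) with ⊓-sel (f k) (foldr (λ k m → f k ⊓ m) (f 0) ks)
  ... | inj₁ eq = k , eq
  ... | inj₂ eq = let (k′ , eq′) = foldr-⊓-sel ks in k′ , trans eq eq′

module _ {A : Set} {P Q : A → Set} (P? : Decidable P) (Q? : Decidable Q) where

  length-filter-mono : P ⊆ Q → ∀ xs → length (filter P? xs) ≤ length (filter Q? xs)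
  length-filter-mono P⊆Q []       = z≤n
  length-filter-mono P⊆Q (x ∷ xs) with P? x | Q? x
  ... | yes _  | yes _  = s≤s (length-filter-mono P⊆Q xs)
  ... | no _   | no _   = length-filter-mono P⊆Q xs
  ... | yes Px | no ¬Qx = ⊥-elim (¬Qx (P⊆Q Px))
  ... | no _   | yes _  = ℕ.m≤n⇒m≤1+n (length-filter-mono P⊆Q xs)

  length-filter-mono-< : P ⊆ Q → ∀ {w} xs → w ∈ xs → Q w → ¬ P w →
                         length (filter P? xs) < length (filter Q? xs)
  length-filter-mono-< P⊆Q (x ∷ xs) (here refl) Qw ¬Pw with P? x | Q? x
  ... | yes Px | _      = ⊥-elim (¬Pw Px)
  ... | no _   | no ¬Qx = ⊥-elim (¬Qx Qw)
  ... | no _   | yes _  = s≤s (length-filter-mono P⊆Q xs)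
  length-filter-mono-< P⊆Q (x ∷ xs) (there w∈xs) Qw ¬Pw
    with ih ← length-filter-mono-< P⊆Q xs w∈xs Qw ¬Pw | P? x | Q? x
  ... | yes _  | yes _  = s≤s ih
  ... | no _   | no _   = ih
  ... | yes Px | no ¬Qx = ⊥-elim (¬Qx (P⊆Q Px))
  ... | no _   | yes _  = ℕ.m≤n⇒m≤1+n ih

  length-filter-cong : ∀ xs → (∀ {x} → x ∈ xs → P x → Q x) → (∀ {x} → x ∈ xs → Q x → P x) →
                       length (filter P? xs) ≡ length (filter Q? xs)
  length-filter-cong []       P⇒Q Q⇒P = refl
  length-filter-cong (x ∷ xs) P⇒Q Q⇒P
    with ih ← length-filter-cong xs (P⇒Q ∘ there) (Q⇒P ∘ there) | P? x | Q? x
  ... | yes _  | yes _  = cong suc ih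
  ... | no _   | no _   = ih
  ... | yes Px | no ¬Qx = ⊥-elim (¬Qx (P⇒Q (here refl) Px))
  ... | no ¬Px | yes Qx = ⊥-elim (¬Px (Q⇒P (here refl) Qx))

  length-filter-except : ∀ {w} → (∀ {x} → x ≢ w → P x → Q x) → (∀ {x} → x ≢ w → Q x → P x) →
                         P w → ¬ Q w → ∀ {xs} → Unique xs → w ∈ xs →
                         length (filter P? xs) ≡ suc (length (filter Q? xs))
  length-filter-except P⇒Q Q⇒P Pw ¬Qw {x ∷ xs} (w∉xs ∷ _) (here refl) with P? x | Q? x
  ... | no ¬Px | _      = ⊥-elim (¬Px Pw)
  ... | yes _  | yes Qx = ⊥-elim (¬Qw Qx)
  ... | yes _  | no _   = cong suc (length-filter-cong xs (P⇒Q ∘ away) (Q⇒P ∘ away))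
    where
    away : ∀ {y} → y ∈ xs → y ≢ x
    away y∈xs = ≢-sym (All.lookup w∉xs y∈xs)
  length-filter-except P⇒Q Q⇒P Pw ¬Qw {x ∷ xs} (x∉xs ∷ uniq) (there w∈xs)
    with ih ← length-filter-except P⇒Q Q⇒P Pw ¬Qw uniq w∈xs | P? x | Q? x
  ... | yes _  | yes _  = cong suc ih
  ... | no _   | no _   = ih
  ... | yes Px | no ¬Qx = ⊥-elim (¬Qx (P⇒Q (All.lookup x∉xs w∈xs) Px))
  ... | no ¬Px | yes Qx = ⊥-elim (¬Px (Q⇒P (All.lookup x∉xs w∈xs) Qx))

module _ {A B : Set} {P : B → Set} (P? : Decidable P) where

  length-filter-map : (f : A → B) → ∀ xs → length (filter P? (map f xs)) ≡ length (filter (P? ∘ f) xs)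
  length-filter-map f []       = refl
  length-filter-map f (x ∷ xs) with P? (f x)
  ... | yes _ = cong suc (length-filter-map f xs)
  ... | no _  = length-filter-map f xs

  length-filter-concatMap : (f : A → List B) {c : A → ℕ} → ∀ {xs} →
                            All (λ x → length (filter P? (f x)) ≡ c x) xs →
                            length (filter P? (concatMap f xs)) ≡ sum (map c xs)
  length-filter-concatMap f []                   = refl
  length-filter-concatMap f {xs = x ∷ xs} (eq ∷ eqs) = begin
    length (filter P? (f x ++ concatMap f xs))                     ≡⟨ cong length (filter-++ P? (f x) _) ⟩
    length (filter P? (f x) ++ filter P? (concatMap f xs))         ≡⟨ length-++ (filter P? (f x)) ⟩
    length (filter P? (f x)) + length (filter P? (concatMap f xs)) ≡⟨ cong₂ _+_ eq (length-filter-concatMap f eqs) ⟩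
    sum (map _ (x ∷ xs))                                           ∎
    where open ≡-Reasoning

module _ {A : Set} {P : A → Set} (P? : Decidable P) where

  sum-indicator : ∀ c xs → sum (map (λ x → if does (P? x) then c else 0) xs) ≡ length (filter P? xs) * c
  sum-indicator c []       = refl
  sum-indicator c (x ∷ xs) with P? x
  ... | yes _ = cong (_+_ c) (sum-indicator c xs)
  ... | no _  = sum-indicator c xs

∑ : {X : Set} → List X → (X → ℤ) → ℤ
∑ xs f = foldr ℤ._+_ 0ℤ (map f xs)

module _ {X : Set} where

  ∑-cong : ∀ xs {f g : X → ℤ} → (∀ {x} → x ∈ xs → f x ≡ g x) → ∑ xs f ≡ ∑ xs g
  ∑-cong xs eq = cong (foldr ℤ._+_ 0ℤ) (map-cong-local (All.tabulate eq))

  ∑-hom : (φ : ℤ → ℤ) → φ 0ℤ ≡ 0ℤ → (∀ x y → φ (x ℤ.+ y) ≡ φ x ℤ.+ φ y) →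
          ∀ xs (f : X → ℤ) → φ (∑ xs f) ≡ ∑ xs (φ ∘ f)
  ∑-hom φ φ0 φ+ []       f = φ0
  ∑-hom φ φ0 φ+ (x ∷ xs) f = trans (φ+ (f x) (∑ xs f)) (cong (ℤ._+_ (φ (f x))) (∑-hom φ φ0 φ+ xs f))

  ∑-zero : ∀ xs → ∑ xs (λ (_ : X) → 0ℤ) ≡ 0ℤ
  ∑-zero []       = refl
  ∑-zero (x ∷ xs) = trans (ℤ.+-identityˡ _) (∑-zero xs)

  ∑-+ : ∀ xs (f g : X → ℤ) → ∑ xs (λ x → f x ℤ.+ g x) ≡ ∑ xs f ℤ.+ ∑ xs g
  ∑-+ []       f g = refl
  ∑-+ (x ∷ xs) f g =
    trans (cong (ℤ._+_ (f x ℤ.+ g x)) (∑-+ xs f g)) (+-interchange (f x) (g x) (∑ xs f) (∑ xs g))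

  ∑-↭ : ∀ {xs ys} (f : X → ℤ) → xs ↭ ys → ∑ xs f ≡ ∑ ys f
  ∑-↭ f p = foldr-commMonoid ℤ+.setoid ℤ+.isCommutativeMonoid (↭⇒↭ₛ (↭.map⁺ f p))
    where module ℤ+ = CommutativeMonoid ℤ.+-0-commutativeMonoid

  ∑-indicator : ∀ {P : X → Set} (P? : Decidable P) z xs →
                z ℤ.* + length (filter P? xs) ≡ ∑ xs (λ x → if does (P? x) then z else 0ℤ)
  ∑-indicator P? z []       = ℤ.*-zeroʳ z
  ∑-indicator P? z (x ∷ xs) with P? x
  ... | yes _ = trans (ℤ.*-distribˡ-+ z 1ℤ _) (cong₂ ℤ._+_ (ℤ.*-identityʳ z) (∑-indicator P? z xs))
  ... | no _  = trans (∑-indicator P? z xs) (sym (ℤ.+-identityˡ _))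

  ∑-pos : ∀ xs (N : X → ℕ) → ∑ xs (λ x → + N x) ≡ + sum (map N xs)
  ∑-pos []       N = refl
  ∑-pos (x ∷ xs) N = trans (cong (ℤ._+_ (+ N x)) (∑-pos xs N)) (sym (ℤ.pos-+ (N x) _))

  sum-≡0 : ∀ {xs} (N : X → ℕ) → sum (map N xs) ≡ 0 → ∀ {x} → x ∈ xs → N x ≡ 0
  sum-≡0 {y ∷ xs} N eq (here refl) = ℕ.m+n≡0⇒m≡0 (N y) eq
  sum-≡0 {y ∷ xs} N eq (there x∈xs) = sum-≡0 N (ℕ.m+n≡0⇒n≡0 (N y) eq) x∈xs

  ∑-nonNegative-≡0 : ∀ xs {f : X → ℤ} → (∀ x → f x ≡ + ℤ.∣ f x ∣) → ∑ xs f ≡ 0ℤ →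
                     ∀ {x} → x ∈ xs → f x ≡ 0ℤ
  ∑-nonNegative-≡0 xs {f} nonNegative eq {x} x∈xs =
    trans (nonNegative x) (cong +_ (sum-≡0 (ℤ.∣_∣ ∘ f) (ℤ.+-injective sum≡0) x∈xs))
    where
    sum≡0 : + sum (map (ℤ.∣_∣ ∘ f) xs) ≡ 0ℤ
    sum≡0 = trans (sym (∑-pos xs (ℤ.∣_∣ ∘ f))) (trans (sym (∑-cong xs (λ {x} _ → nonNegative x))) eq)

module _ {X Y : Set} where

  ∑-map : ∀ (f : X → Y) (F : Y → ℤ) xs → ∑ (map f xs) F ≡ ∑ xs (F ∘ f)
  ∑-map f F xs = cong (foldr ℤ._+_ 0ℤ) (sym (map-∘ xs))

  ∑-swap : ∀ xs ys (H : X → Y → ℤ) → ∑ xs (λ x → ∑ ys (H x)) ≡ ∑ ys (λ y → ∑ xs (λ x → H x y))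
  ∑-swap []       ys H = sym (∑-zero ys)
  ∑-swap (x ∷ xs) ys H = trans (cong (ℤ._+_ (∑ ys (H x))) (∑-swap xs ys H)) (sym (∑-+ ys (H x) _))

-1^-suc : ∀ k → -1ℤ ^ suc k ≡ - (-1ℤ ^ k)
-1^-suc k = -1*i≡-i (-1ℤ ^ k)

-1^-unit : ∀ k → -1ℤ ^ k ≡ 1ℤ ⊎ -1ℤ ^ k ≡ -1ℤ
-1^-unit zero    = inj₁ refl
-1^-unit (suc k) with -1^-unit k
... | inj₁ eq = inj₂ (trans (-1^-suc k) (cong -_ eq))
... | inj₂ eq = inj₁ (trans (-1^-suc k) (cong -_ eq))

-1^-square : ∀ k → -1ℤ ^ k ℤ.* -1ℤ ^ k ≡ 1ℤ
-1^-square k with -1^-unit k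
... | inj₁ eq = cong₂ ℤ._*_ eq eq
... | inj₂ eq = cong₂ ℤ._*_ eq eq

x≡-x⇒x≡0 : ∀ {x} → x ≡ - x → x ≡ 0ℤ
x≡-x⇒x≡0 {+ zero}     _  = refl
x≡-x⇒x≡0 {+[1+ _ ]}   ()
x≡-x⇒x≡0 { -[1+ _ ] } ()

-1^-cancel : ∀ k {x} → -1ℤ ^ k ℤ.* x ≡ 0ℤ → x ≡ 0ℤ
-1^-cancel k eq with ℤ.i*j≡0⇒i≡0∨j≡0 (-1ℤ ^ k) eq
... | inj₁ -1^k≡0 = case ℤ.i^n≡0⇒i≡0 -1ℤ k -1^k≡0 of λ ()
... | inj₂ x≡0    = x≡0

[-a]^k≡-1^k*a^k : ∀ a k → (- (+ a)) ^ k ≡ -1ℤ ^ k ℤ.* + (a ℕ.^ k)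
[-a]^k≡-1^k*a^k a zero    = refl
[-a]^k≡-1^k*a^k a (suc k) = begin
  (- (+ a)) ℤ.* (- (+ a)) ^ k
    ≡⟨ cong₂ ℤ._*_ (-1*i≡-i (+ a)) (sym ([-a]^k≡-1^k*a^k a k)) ⟨
  (-1ℤ ℤ.* + a) ℤ.* (-1ℤ ^ k ℤ.* + (a ℕ.^ k))
    ≡⟨ *-interchange -1ℤ (+ a) (-1ℤ ^ k) (+ (a ℕ.^ k)) ⟩
  (-1ℤ ℤ.* -1ℤ ^ k) ℤ.* (+ a ℤ.* + (a ℕ.^ k))
    ≡⟨ cong (ℤ._*_ (-1ℤ ^ suc k)) (ℤ.pos-* a (a ℕ.^ k)) ⟨
  -1ℤ ^ suc k ℤ.* + (a ℕ.^ suc k)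
    ∎
  where open ≡-Reasoning

-- Cycles of a permutation

module _ {n : ℕ} where

  lookup-ext : {g h : Map n} → (∀ i → lookup g i ≡ lookup h i) → g ≡ h
  lookup-ext {g} {h} eq = trans (sym (tabulate∘lookup g)) (trans (tabulate-cong eq) (tabulate∘lookup h))

  lookup-∘ₚ : (g h : Map n) (i : Fin n) → lookup (g ∘ₚ h) i ≡ lookup g (lookup h i)
  lookup-∘ₚ g h i = lookup∘tabulate _ i

  lookup-idₚ : (i : Fin n) → lookup idₚ i ≡ i
  lookup-idₚ i = lookup∘tabulate (λ x → x) i

  ∘ₚ-assoc : (g h k : Map n) → (g ∘ₚ h) ∘ₚ k ≡ g ∘ₚ (h ∘ₚ k)
  ∘ₚ-assoc g h k = lookup-ext λ i → begin
    lookup ((g ∘ₚ h) ∘ₚ k) i          ≡⟨ lookup-∘ₚ (g ∘ₚ h) k i ⟩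
    lookup (g ∘ₚ h) (lookup k i)      ≡⟨ lookup-∘ₚ g h _ ⟩
    lookup g (lookup h (lookup k i))  ≡⟨ cong (lookup g) (lookup-∘ₚ h k i) ⟨
    lookup g (lookup (h ∘ₚ k) i)      ≡⟨ lookup-∘ₚ g (h ∘ₚ k) i ⟨
    lookup (g ∘ₚ (h ∘ₚ k)) i          ∎
    where open ≡-Reasoning

  ∘ₚ-identityˡ : (g : Map n) → idₚ ∘ₚ g ≡ g
  ∘ₚ-identityˡ g = lookup-ext λ i → trans (lookup-∘ₚ idₚ g i) (lookup-idₚ _)

  ∘ₚ-identityʳ : (g : Map n) → g ∘ₚ idₚ ≡ g
  ∘ₚ-identityʳ g = lookup-ext λ i → trans (lookup-∘ₚ g idₚ i) (cong (lookup g) (lookup-idₚ i))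

  record IsPerm (g : Map n) : Set where
    constructor isPerm
    field injective : ∀ i j → lookup g i ≡ lookup g j → i ≡ j
  open IsPerm public

  ∘ₚ-isPerm : {g h : Map n} → IsPerm g → IsPerm h → IsPerm (g ∘ₚ h)
  ∘ₚ-isPerm {g} {h} pg ph = isPerm λ i j eq → injective ph i j (injective pg _ _
    (trans (sym (lookup-∘ₚ g h i)) (trans eq (lookup-∘ₚ g h j))))

  iter-+ : (g : Map n) (k l : ℕ) (i : Fin n) → iter g (k + l) i ≡ iter g k (iter g l i)
  iter-+ g zero    l i = refl
  iter-+ g (suc k) l i = cong (lookup g) (iter-+ g k l i)

  iter-injective : {g : Map n} → IsPerm g → ∀ k {i j} → iter g k i ≡ iter g k j → i ≡ j
  iter-injective pg zero    eq = eq
  iter-injective pg (suc k) eq = iter-injective pg k (injective pg _ _ eq)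

  iter-*-fixed : (g : Map n) (m : ℕ) (i : Fin n) → iter g m i ≡ i → ∀ t → iter g (t * m) i ≡ i
  iter-*-fixed g m i eq zero    = refl
  iter-*-fixed g m i eq (suc t) =
    trans (iter-+ g m (t * m) i) (trans (cong (iter g m) (iter-*-fixed g m i eq t)) eq)

  -- Pigeonhole on i, g i, …, gⁿ i, then cancel the common prefix by injectivity.
  period : {g : Map n} → IsPerm g → ∀ i → Σ ℕ λ m → suc m ≤ n × iter g (suc m) i ≡ i
  period {g} pg i with pigeonhole (n<1+n n) (λ k → iter g (toℕ k) i)
  ... | p , q , p<q , eq = shift (toℕ q ∸ toℕ p) (ℕ.m<n⇒0<n∸m p<q) d≤n (sym returns)
    where
    d = toℕ q ∸ toℕ p
    returns : i ≡ iter g d i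
    returns = iter-injective pg (toℕ p) (trans eq
      (trans (cong (λ k → iter g k i) (sym (ℕ.m+[n∸m]≡n (<⇒≤ p<q)))) (iter-+ g (toℕ p) d i)))
    d≤n : d ≤ n
    d≤n = ≤-trans (ℕ.m∸n≤m (toℕ q) (toℕ p)) (ℕ.≤-pred (toℕ<n q))
    shift : ∀ d → 1 ≤ d → d ≤ n → iter g d i ≡ i → Σ ℕ λ m → suc m ≤ n × iter g (suc m) i ≡ i
    shift (suc m) _ le eq′ = m , le , eq′

  Reach : Map n → Fin n → Fin n → Set
  Reach g i j = ∃ λ k → iter g k i ≡ j

  reach-refl : ∀ {g i} → Reach g i i
  reach-refl = 0 , refl

  reach-step : ∀ {g i} → Reach g i (lookup g i)
  reach-step = 1 , refl

  reach-trans : ∀ {g i j k} → Reach g i j → Reach g j k → Reach g i k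
  reach-trans {g} {i} (k , refl) (l , refl) = l + k , iter-+ g l k i

  -- Going once more around the cycle of i lands back on i.
  reach-sym : ∀ {g} → IsPerm g → ∀ {i j} → Reach g i j → Reach g j i
  reach-sym {g} pg {i} (k , refl) with period pg i
  ... | m , _ , returns = k * suc m ∸ k , (begin
    iter g (k * suc m ∸ k) (iter g k i)  ≡⟨ iter-+ g (k * suc m ∸ k) k i ⟨
    iter g (k * suc m ∸ k + k) i         ≡⟨ cong (λ l → iter g l i) (ℕ.m∸n+n≡m (m≤m*n k (suc m))) ⟩
    iter g (k * suc m) i                 ≡⟨ iter-*-fixed g (suc m) i returns k ⟩
    i                                    ∎)
    where open ≡-Reasoning

  reach-bounded : ∀ {g} → IsPerm g → ∀ {i j} → Reach g i j → ∃ λ k → k < n × iter g k i ≡ j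
  reach-bounded {g} pg {i} (k , refl) with period pg i
  ... | m , m<n , returns = k % suc m , <-≤-trans (m%n<n k (suc m)) m<n , (begin
    iter g (k % suc m) i
      ≡⟨ cong (iter g (k % suc m)) (iter-*-fixed g (suc m) i returns (k / suc m)) ⟨
    iter g (k % suc m) (iter g (k / suc m * suc m) i)
      ≡⟨ iter-+ g (k % suc m) (k / suc m * suc m) i ⟨
    iter g (k % suc m + k / suc m * suc m) i
      ≡⟨ cong (λ l → iter g l i) (m≡m%n+[m/n]*n k (suc m)) ⟨
    iter g k i
      ∎)
    where open ≡-Reasoning

  orbitMin-≤ : (g : Map n) (i : Fin n) → orbitMin g i ≤ toℕ i
  orbitMin-≤ g i = foldr-⊓-≤-init (λ k → toℕ (iter g k i)) (toℕ i) (upTo n)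

  orbitMin-≤-reach : ∀ {g} → IsPerm g → ∀ {i j} → Reach g i j → orbitMin g i ≤ toℕ j
  orbitMin-≤-reach {g} pg {i} r with reach-bounded pg r
  ... | k , k<n , refl = foldr-⊓-≤ (λ k → toℕ (iter g k i)) (toℕ i) (upTo n) (∈-upTo⁺ k<n)

  orbitMin-attained : (g : Map n) (i : Fin n) → ∃ λ j → Reach g i j × orbitMin g i ≡ toℕ j
  orbitMin-attained g i with foldr-⊓-sel (λ k → toℕ (iter g k i)) (upTo n)
  ... | k , eq = iter g k i , (k , refl) , eq

  orbitMin-reach : ∀ {g} → IsPerm g → ∀ {i j} → Reach g i j → orbitMin g i ≡ orbitMin g j
  orbitMin-reach {g} pg {i} {j} r with orbitMin-attained g i | orbitMin-attained g j
  ... | a , ra , eqa | b , rb , eqb = ≤-antisym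
    (subst (orbitMin g i ≤_) (sym eqb) (orbitMin-≤-reach pg (reach-trans r rb)))
    (subst (orbitMin g j ≤_) (sym eqa) (orbitMin-≤-reach pg (reach-trans (reach-sym pg r) ra)))

  orbitMin-≡⇒reach : ∀ {g} → IsPerm g → ∀ {u v} → orbitMin g u ≡ orbitMin g v → Reach g u v
  orbitMin-≡⇒reach {g} pg {u} {v} eq with orbitMin-attained g u | orbitMin-attained g v
  ... | a , ra , eqa | b , rb , eqb with toℕ-injective (trans (sym eqa) (trans eq eqb))
  ... | refl = reach-trans ra (reach-sym pg rb)

  IsCycleMin : Map n → Fin n → Set
  IsCycleMin g i = toℕ i ≡ orbitMin g i

  cycleMin-≤ : ∀ {g} → IsPerm g → ∀ {i} → IsCycleMin g i → ∀ {j} → Reach g i j → toℕ i ≤ toℕ j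
  cycleMin-≤ pg {i} min r = subst (_≤ _) (sym min) (orbitMin-≤-reach pg r)

  cycleMin-intro : ∀ {g i} → (∀ {j} → Reach g i j → toℕ i ≤ toℕ j) → IsCycleMin g i
  cycleMin-intro {g} {i} least with orbitMin-attained g i
  ... | j , r , eq = ≤-antisym (subst (toℕ i ≤_) (sym eq) (least r)) (orbitMin-≤ g i)

-- Composing with a transposition

module _ {n : ℕ} where

  transpose-at-i : (i j : Fin n) → transpose i j i ≡ j
  transpose-at-i i j with i ≟ i
  ... | yes _  = refl
  ... | no i≢i = ⊥-elim (i≢i refl)

  transpose-at-j : (i j : Fin n) → transpose i j j ≡ i
  transpose-at-j i j with j ≟ i
  ... | yes j≡i = j≡i
  ... | no _ with j ≟ j
  ...   | yes _  = refl
  ...   | no j≢j = ⊥-elim (j≢j refl)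

  transpose-other : (i j : Fin n) {k : Fin n} → k ≢ i → k ≢ j → transpose i j k ≡ k
  transpose-other i j {k} k≢i k≢j with k ≟ i
  ... | yes k≡i = ⊥-elim (k≢i k≡i)
  ... | no _ with k ≟ j
  ...   | yes k≡j = ⊥-elim (k≢j k≡j)
  ...   | no _    = refl

  data TransposeView (i j k : Fin n) : Set where
    at-i  : k ≡ i → TransposeView i j k
    at-j  : k ≡ j → k ≢ i → TransposeView i j k
    other : k ≢ i → k ≢ j → TransposeView i j k

  transpose-view : (i j k : Fin n) → TransposeView i j k
  transpose-view i j k with k ≟ i | k ≟ j
  ... | yes k≡i | _       = at-i k≡i
  ... | no k≢i  | yes k≡j = at-j k≡j k≢i
  ... | no k≢i  | no k≢j  = other k≢i k≢j

  transpose-comm : (i j k : Fin n) → transpose i j k ≡ transpose j i k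
  transpose-comm i j k with transpose-view i j k
  ... | at-i refl      = trans (transpose-at-i i j) (sym (transpose-at-j j i))
  ... | at-j refl _    = trans (transpose-at-j i j) (sym (transpose-at-i j i))
  ... | other k≢i k≢j  = trans (transpose-other i j k≢i k≢j) (sym (transpose-other j i k≢j k≢i))

  transpose-involutive : (i j k : Fin n) → transpose i j (transpose i j k) ≡ k
  transpose-involutive i j k = trans (cong (transpose i j) (transpose-comm i j k)) (transpose-inverse i j)

  transposition : Fin n → Fin n → Map n
  transposition u v = tabulate (transpose u v)

  lookup-∘-transposition : (g : Map n) (u v x : Fin n) →
                           lookup (g ∘ₚ transposition u v) x ≡ lookup g (transpose u v x)
  lookup-∘-transposition g u v x =
    trans (lookup-∘ₚ g (transposition u v) x) (cong (lookup g) (lookup∘tabulate (transpose u v) x))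

  transposition-comm : (u v : Fin n) → transposition u v ≡ transposition v u
  transposition-comm u v = tabulate-cong (transpose-comm u v)

  transposition-isPerm : (u v : Fin n) → IsPerm (transposition u v)
  transposition-isPerm u v = isPerm λ i j eq → begin
    i                                ≡⟨ transpose-involutive u v i ⟨
    transpose u v (transpose u v i)  ≡⟨ cong (transpose u v) (trans (sym (lookup-τ i)) (trans eq (lookup-τ j))) ⟩
    transpose u v (transpose u v j)  ≡⟨ transpose-involutive u v j ⟩
    j                                ∎
    where
    open ≡-Reasoning
    lookup-τ = lookup∘tabulate (transpose u v)

  ∘-transposition-twice : (g : Map n) (u v : Fin n) → (g ∘ₚ transposition u v) ∘ₚ transposition u v ≡ g
  ∘-transposition-twice g u v = lookup-ext λ x → begin
    lookup ((g ∘ₚ τ) ∘ₚ τ) x                    ≡⟨ lookup-∘-transposition (g ∘ₚ τ) u v x ⟩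
    lookup (g ∘ₚ τ) (transpose u v x)           ≡⟨ lookup-∘-transposition g u v _ ⟩
    lookup g (transpose u v (transpose u v x))  ≡⟨ cong (lookup g) (transpose-involutive u v x) ⟩
    lookup g x                                  ∎
    where
    open ≡-Reasoning
    τ = transposition u v

  module _ {g : Map n} (pg : IsPerm g) {u v : Fin n} where

    private
      h = g ∘ₚ transposition u v

      ph : IsPerm h
      ph = ∘ₚ-isPerm pg (transposition-isPerm u v)

      lookup-h-u : lookup h u ≡ lookup g v
      lookup-h-u = trans (lookup-∘-transposition g u v u) (cong (lookup g) (transpose-at-i u v))

      lookup-h-v : lookup h v ≡ lookup g u
      lookup-h-v = trans (lookup-∘-transposition g u v v) (cong (lookup g) (transpose-at-j u v))

      lookup-h-other : ∀ {x} → x ≢ u → x ≢ v → lookup h x ≡ lookup g x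
      lookup-h-other x≢u x≢v =
        trans (lookup-∘-transposition g u v _) (cong (lookup g) (transpose-other u v x≢u x≢v))

    -- The h-orbit of u runs along the g-orbit of v, which never meets u, until it is back at v.
    reach-∘-transposition-join : ¬ Reach g u v → Reach (g ∘ₚ transposition u v) u v
    reach-∘-transposition-join ¬uv with period pg v
    ... | m , _ , returns = subst (Reach h u) returns (follows m)
      where
      follows : ∀ k → Reach h u (iter g (suc k) v)
      follows zero = subst (Reach h u) lookup-h-u reach-step
      follows (suc k) with transpose-view u v (iter g (suc k) v)
      ... | at-i w≡u         = ⊥-elim (¬uv (reach-sym pg (suc k , w≡u)))
      ... | at-j w≡v _       = subst (Reach h u) (cong (lookup g) (sym w≡v)) (follows zero)
      ... | other w≢u w≢v    = reach-trans (follows k) (subst (Reach h _) (lookup-h-other w≢u w≢v) reach-step)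

    -- If v = g^(1+l) u with l least, then v, g u, …, g^l u is an h-cycle, and it avoids u.
    reach-∘-transposition-split : u ≢ v → Reach g u v → ¬ Reach (g ∘ₚ transposition u v) v u
    reach-∘-transposition-split u≢v (zero , u≡v) _ = u≢v u≡v
    reach-∘-transposition-split u≢v (suc k , reached) (t , back)
      with leastWitness {P = λ l → iter g (suc l) u ≡ v} (λ l → iter g (suc l) u ≟ v) {k} reached
    ... | l , hits , first = ¬S-u (subst S back (S-iter t (inj₁ refl)))
      where
      S : Fin n → Set
      S x = x ≡ v ⊎ ∃ λ k → k < l × iter g (suc k) u ≡ x

      noReturn : ∀ k → k < l → iter g (suc k) u ≢ u
      noReturn k k<l returns = first (l ∸ suc k) (ℕ.∸-monoʳ-< {o = 0} (s≤s z≤n) k<l) (begin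
        iter g (suc (l ∸ suc k)) u                      ≡⟨ cong (iter g (suc (l ∸ suc k))) returns ⟨
        iter g (suc (l ∸ suc k)) (iter g (suc k) u)     ≡⟨ iter-+ g (suc (l ∸ suc k)) (suc k) u ⟨
        iter g (suc (l ∸ suc k) + suc k) u              ≡⟨ cong (λ j → iter g (suc j) u) (ℕ.m∸n+n≡m k<l) ⟩
        iter g (suc l) u                                ≡⟨ hits ⟩
        v                                               ∎)
        where open ≡-Reasoning

      next : ∀ k → k ≤ l → S (iter g (suc k) u)
      next k k≤l with k ℕ.≟ l
      ... | yes refl = inj₁ hits
      ... | no k≢l   = inj₂ (k , ℕ.≤∧≢⇒< k≤l k≢l , refl)

      S-step : ∀ {x} → S x → S (lookup h x)
      S-step (inj₁ refl) = subst S (sym lookup-h-v) (next 0 z≤n)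
      S-step (inj₂ (k , k<l , refl)) =
        subst S (sym (lookup-h-other (noReturn k k<l) (first k k<l))) (next (suc k) k<l)

      S-iter : ∀ t {x} → S x → S (iter h t x)
      S-iter zero    Sx = Sx
      S-iter (suc t) Sx = S-step (S-iter t Sx)

      ¬S-u : ¬ S u
      ¬S-u (inj₁ u≡v)             = u≢v u≡v
      ¬S-u (inj₂ (k , k<l , eq))  = noReturn k k<l eq

    module _ (¬uv : ¬ Reach g u v) where

      private
        Linked : Fin n → Set
        Linked x = Reach g x u ⊎ Reach g x v

        -- The h-orbits are those of g, except that the orbits of u and v are fused.
        Merged : Fin n → Fin n → Set
        Merged x y = Reach g x y ⊎ (Linked x × Linked y)

        linked-back : ∀ {x y} → Reach g x y → Linked y → Linked x
        linked-back r = Sum.map (reach-trans r) (reach-trans r)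

        merged-trans : ∀ {x y z} → Merged x y → Merged y z → Merged x z
        merged-trans (inj₁ rxy)        (inj₁ ryz)        = inj₁ (reach-trans rxy ryz)
        merged-trans (inj₁ rxy)        (inj₂ (ly , lz))  = inj₂ (linked-back rxy ly , lz)
        merged-trans (inj₂ (lx , ly))  (inj₁ ryz)        = inj₂ (lx , linked-back (reach-sym pg ryz) ly)
        merged-trans (inj₂ (lx , _))   (inj₂ (_ , lz))   = inj₂ (lx , lz)

        merged-transpose : ∀ z → Merged z (transpose u v z)
        merged-transpose z with transpose-view u v z
        ... | at-i refl     = subst (Merged u) (sym (transpose-at-i u v)) (inj₂ (inj₁ reach-refl , inj₂ reach-refl))
        ... | at-j refl _   = subst (Merged v) (sym (transpose-at-j u v)) (inj₂ (inj₂ reach-refl , inj₁ reach-refl))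
        ... | other z≢u z≢v = subst (Merged z) (sym (transpose-other u v z≢u z≢v)) (inj₁ reach-refl)

        merged-along : ∀ {x} k → Merged x (iter h k x)
        merged-along zero    = inj₁ reach-refl
        merged-along (suc k) = subst (Merged _) (sym (lookup-∘-transposition g u v _))
          (merged-trans (merged-along k) (merged-trans (merged-transpose _) (inj₁ reach-step)))

        reach⇒merged : ∀ {x y} → Reach h x y → Merged x y
        reach⇒merged (k , refl) = merged-along k

        u-reaches-v : Reach h u v
        u-reaches-v = reach-∘-transposition-join ¬uv

        reaches-g-image : ∀ z → Reach h z (lookup g z)
        reaches-g-image z with transpose-view u v z
        ... | at-i refl     = reach-trans u-reaches-v (subst (Reach h v) lookup-h-v reach-step)
        ... | at-j refl _   = reach-trans (reach-sym ph u-reaches-v) (subst (Reach h u) lookup-h-u reach-step)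
        ... | other z≢u z≢v = subst (Reach h z) (lookup-h-other z≢u z≢v) reach-step

        reaches-g-orbit : ∀ {x} k → Reach h x (iter g k x)
        reaches-g-orbit zero    = reach-refl
        reaches-g-orbit (suc k) = reach-trans (reaches-g-orbit k) (reaches-g-image _)

        reach-g⇒h : ∀ {x y} → Reach g x y → Reach h x y
        reach-g⇒h (k , refl) = reaches-g-orbit k

        linked⇒reach : ∀ {x} → Linked x → Reach h x u
        linked⇒reach (inj₁ rxu) = reach-g⇒h rxu
        linked⇒reach (inj₂ rxv) = reach-trans (reach-g⇒h rxv) (reach-sym ph u-reaches-v)

        merged⇒reach : ∀ {x y} → Merged x y → Reach h x y
        merged⇒reach (inj₁ rxy)       = reach-g⇒h rxy
        merged⇒reach (inj₂ (lx , ly)) = reach-trans (linked⇒reach lx) (reach-sym ph (linked⇒reach ly))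

      -- Of the two cycle minima of u and v, the larger one is no longer a cycle minimum.
      cycles-∘-transposition-join< : orbitMin g u < orbitMin g v → cycles g ≡ suc (cycles (g ∘ₚ transposition u v))
      cycles-∘-transposition-join< u<v with orbitMin-attained g u | orbitMin-attained g v
      ... | a , rua , eqa | b , rvb , eqb = length-filter-except
        (λ i → toℕ i ℕ.≟ orbitMin g i) (λ i → toℕ i ℕ.≟ orbitMin h i)
        g-min⇒h-min h-min⇒g-min min-b ¬h-min-b (Unique.allFin⁺ n) (∈-allFin b)
        where
        orbitMin-u-≤ : ∀ {j} → Linked j → orbitMin g u ≤ orbitMin g j
        orbitMin-u-≤ (inj₁ rju) = ℕ.≤-reflexive (orbitMin-reach pg (reach-sym pg rju))
        orbitMin-u-≤ (inj₂ rjv) = ≤-trans (<⇒≤ u<v) (ℕ.≤-reflexive (orbitMin-reach pg (reach-sym pg rjv)))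

        min-b : IsCycleMin g b
        min-b = trans (sym eqb) (orbitMin-reach pg rvb)

        ¬h-min-b : ¬ IsCycleMin h b
        ¬h-min-b min = ℕ.<⇒≱ (subst₂ _<_ eqa eqb u<v)
          (cycleMin-≤ ph min (merged⇒reach (inj₂ (inj₂ (reach-sym pg rvb) , inj₁ (reach-sym pg rua)))))

        g-min⇒h-min : ∀ {x} → x ≢ b → IsCycleMin g x → IsCycleMin h x
        g-min⇒h-min {x} x≢b min = cycleMin-intro (below ∘ reach⇒merged)
          where
          below : ∀ {j} → Merged x j → toℕ x ≤ toℕ j
          below (inj₁ rxj)             = cycleMin-≤ pg min rxj
          below (inj₂ (inj₁ rxu , lj)) = ≤-trans (ℕ.≤-reflexive (trans min (orbitMin-reach pg rxu)))
                                           (≤-trans (orbitMin-u-≤ lj) (orbitMin-≤ g _))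
          below (inj₂ (inj₂ rxv , _))  =
            ⊥-elim (x≢b (toℕ-injective (trans min (trans (orbitMin-reach pg rxv) eqb))))

        h-min⇒g-min : ∀ {x} → x ≢ b → IsCycleMin h x → IsCycleMin g x
        h-min⇒g-min _ min = cycleMin-intro λ r → cycleMin-≤ ph min (reach-g⇒h r)

  cycles-∘-transposition-join : ∀ {g} → IsPerm g → ∀ {u v} → ¬ Reach g u v →
                                cycles g ≡ suc (cycles (g ∘ₚ transposition u v))
  cycles-∘-transposition-join {g} pg {u} {v} ¬uv with ℕ.<-cmp (orbitMin g u) (orbitMin g v)
  ... | tri< u<v _ _ = cycles-∘-transposition-join< pg ¬uv u<v
  ... | tri≈ _ eq _  = ⊥-elim (¬uv (orbitMin-≡⇒reach pg eq))
  ... | tri> _ _ v<u = subst (λ τ → cycles g ≡ suc (cycles (g ∘ₚ τ))) (transposition-comm v u)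
                         (cycles-∘-transposition-join< pg (¬uv ∘ reach-sym pg) v<u)

  -- Splitting a cycle is the inverse of joining two, since composing with τ again gives back g.
  cycles-∘-transposition : ∀ {g} → IsPerm g → ∀ {u v} → u ≢ v →
                           cycles g ≡ suc (cycles (g ∘ₚ transposition u v)) ⊎
                           cycles (g ∘ₚ transposition u v) ≡ suc (cycles g)
  cycles-∘-transposition {g} pg {u} {v} u≢v with orbitMin g u ℕ.≟ orbitMin g v
  ... | no ≢min = inj₁ (cycles-∘-transposition-join pg (≢min ∘ orbitMin-reach pg))
  ... | yes eq  = inj₂ (subst (λ g′ → cycles h ≡ suc (cycles g′)) (∘-transposition-twice g u v)
                    (cycles-∘-transposition-join ph ¬h-uv))
    where
    h = g ∘ₚ transposition u v
    ph = ∘ₚ-isPerm pg (transposition-isPerm u v)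
    ¬h-uv : ¬ Reach h u v
    ¬h-uv = reach-∘-transposition-split pg u≢v (orbitMin-≡⇒reach pg eq) ∘ reach-sym ph

-- The sign of a permutation

module _ {n : ℕ} where

  -- (-1)^(c(g) + c(id)) = (-1)^(n - c(g)) is the usual sign of g.
  sign : Map n → ℤ
  sign g = -1ℤ ^ (cycles g + cycles (idₚ {n}))

  sign-idₚ : sign idₚ ≡ 1ℤ
  sign-idₚ = trans (ℤ.^-distribˡ-+-* -1ℤ c c) (-1^-square c)
    where c = cycles (idₚ {n})

  sign-±1 : (g : Map n) → sign g ≡ 1ℤ ⊎ sign g ≡ -1ℤ
  sign-±1 g = -1^-unit (cycles g + cycles (idₚ {n}))

  -1^cycles≡-1^cycles[id]*sign : (g : Map n) → -1ℤ ^ cycles g ≡ -1ℤ ^ cycles (idₚ {n}) ℤ.* sign g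
  -1^cycles≡-1^cycles[id]*sign g = begin
    -1ℤ ^ k                                ≡⟨ ℤ.*-identityʳ _ ⟨
    -1ℤ ^ k ℤ.* 1ℤ                          ≡⟨ cong (ℤ._*_ (-1ℤ ^ k)) (-1^-square c) ⟨
    -1ℤ ^ k ℤ.* (-1ℤ ^ c ℤ.* -1ℤ ^ c)        ≡⟨ ℤ.*-assoc (-1ℤ ^ k) _ _ ⟨
    (-1ℤ ^ k ℤ.* -1ℤ ^ c) ℤ.* -1ℤ ^ c        ≡⟨ ℤ.*-comm _ (-1ℤ ^ c) ⟩
    -1ℤ ^ c ℤ.* (-1ℤ ^ k ℤ.* -1ℤ ^ c)        ≡⟨ cong (ℤ._*_ (-1ℤ ^ c)) (ℤ.^-distribˡ-+-* -1ℤ k c) ⟨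
    -1ℤ ^ c ℤ.* sign g                      ∎
    where
    open ≡-Reasoning
    k = cycles g
    c = cycles (idₚ {n})

  sign-∘-transposition : ∀ {g} → IsPerm g → ∀ {u v} → u ≢ v → sign (g ∘ₚ transposition u v) ≡ - sign g
  sign-∘-transposition {g} pg {u} {v} u≢v with cycles-∘-transposition pg u≢v
  ... | inj₁ eq = begin
    sign gτ                             ≡⟨ neg-involutive (sign gτ) ⟨
    - - sign gτ                         ≡⟨ cong -_ (-1^-suc (cycles gτ + c)) ⟨
    - (-1ℤ ^ (suc (cycles gτ) + c))     ≡⟨ cong (λ k → - (-1ℤ ^ (k + c))) eq ⟨
    - sign g                            ∎
    where
    open ≡-Reasoning
    gτ = g ∘ₚ transposition u v
    c = cycles (idₚ {n})
  ... | inj₂ eq = trans (cong (λ k → -1ℤ ^ (k + c)) eq) (-1^-suc (cycles g + c))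
    where c = cycles (idₚ {n})

  moved : Map n → ℕ
  moved h = length (filter (λ i → ¬? (lookup h i ≟ i)) (List.allFin n))

  -- With v = h⁻¹ u, the map h ∘ (u v) fixes u and every fixed point of h.
  moved-∘-transposition : ∀ {h} → IsPerm h → ∀ {u} → lookup h u ≢ u →
                          ∃ λ v → u ≢ v × moved (h ∘ₚ transposition u v) < moved h
  moved-∘-transposition {h} ph {u} hu≢u with period ph u
  ... | m , _ , hv≡u = v , u≢v , length-filter-mono-<
    (λ i → ¬? (lookup h′ i ≟ i)) (λ i → ¬? (lookup h i ≟ i))
    (λ h′x≢x hx≡x → h′x≢x (fixed-stays hx≡x))
    (List.allFin n) (∈-allFin u) hu≢u (λ h′u≢u → h′u≢u h′u≡u)
    where
    v = iter h m u
    h′ = h ∘ₚ transposition u v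

    u≢v : u ≢ v
    u≢v u≡v = hu≢u (trans (cong (lookup h) u≡v) hv≡u)

    fixed-stays : ∀ {x} → lookup h x ≡ x → lookup h′ x ≡ x
    fixed-stays {x} hx≡x =
      trans (lookup-∘-transposition h u v x) (trans (cong (lookup h) (transpose-other u v x≢u x≢v)) hx≡x)
      where
      x≢u : x ≢ u
      x≢u refl = hu≢u hx≡x
      x≢v : x ≢ v
      x≢v refl = u≢v (trans (sym hv≡u) hx≡x)

    h′u≡u : lookup h′ u ≡ u
    h′u≡u = trans (lookup-∘-transposition h u v u) (trans (cong (lookup h) (transpose-at-i u v)) hv≡u)

  sign-∘ₚ : ∀ {g h} → IsPerm g → IsPerm h → sign (g ∘ₚ h) ≡ sign g ℤ.* sign h
  sign-∘ₚ {h = h} pg ph = go pg ph (<-wellFounded (moved h))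
    where
    open ≡-Reasoning
    go : ∀ {g h} → IsPerm g → IsPerm h → Acc _<_ (moved h) → sign (g ∘ₚ h) ≡ sign g ℤ.* sign h
    go {g} {h} pg ph (acc smaller) with all? (λ i → lookup h i ≟ i)
    ... | yes fixed = begin
      sign (g ∘ₚ h)         ≡⟨ cong (λ h → sign (g ∘ₚ h)) h≡id ⟩
      sign (g ∘ₚ idₚ)       ≡⟨ cong sign (∘ₚ-identityʳ g) ⟩
      sign g                ≡⟨ ℤ.*-identityʳ (sign g) ⟨
      sign g ℤ.* 1ℤ         ≡⟨ cong (sign g ℤ.*_) (trans (cong sign h≡id) sign-idₚ) ⟨
      sign g ℤ.* sign h     ∎
      where
      h≡id : h ≡ idₚ
      h≡id = lookup-ext λ i → trans (fixed i) (sym (lookup-idₚ i))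
    ... | no notAll with ¬∀⟶∃¬ n _ (λ i → lookup h i ≟ i) notAll
    ... | u , hu≢u with moved-∘-transposition ph hu≢u
    ... | v , u≢v , fewer = begin
      sign (g ∘ₚ h)                     ≡⟨ cong (λ h → sign (g ∘ₚ h)) (∘-transposition-twice h u v) ⟨
      sign (g ∘ₚ (h′ ∘ₚ τ))             ≡⟨ cong sign (∘ₚ-assoc g h′ τ) ⟨
      sign ((g ∘ₚ h′) ∘ₚ τ)             ≡⟨ sign-∘-transposition (∘ₚ-isPerm pg ph′) u≢v ⟩
      - sign (g ∘ₚ h′)                  ≡⟨ cong -_ (go pg ph′ (smaller fewer)) ⟩
      - (sign g ℤ.* sign h′)            ≡⟨ ℤ.neg-distribʳ-* (sign g) (sign h′) ⟩
      sign g ℤ.* - sign h′              ≡⟨ cong (sign g ℤ.*_) (sign-∘-transposition ph′ u≢v) ⟨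
      sign g ℤ.* sign (h′ ∘ₚ τ)         ≡⟨ cong (λ h → sign g ℤ.* sign h) (∘-transposition-twice h u v) ⟩
      sign g ℤ.* sign h                 ∎
      where
      τ = transposition u v
      h′ = h ∘ₚ τ
      ph′ = ∘ₚ-isPerm ph (transposition-isPerm u v)

-- Colourings fixed by a permutation

module _ (a : ℕ) where

  Colouring : Set
  Colouring = List (Fin (suc a))

  -- Positions beyond the end read as colour 0; only positions below the length are ever used.
  at : Colouring → ℕ → Fin (suc a)
  at []      _       = Fin.zero
  at (x ∷ w) zero    = x
  at (x ∷ w) (suc k) = at w k

  at-∷ʳ-< : ∀ w x {k} → k < length w → at (w ∷ʳ x) k ≡ at w k
  at-∷ʳ-< (y ∷ w) x {zero}  _         = refl
  at-∷ʳ-< (y ∷ w) x {suc k} (s≤s k<l) = at-∷ʳ-< w x k<l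

  at-∷ʳ-length : ∀ w x → at (w ∷ʳ x) (length w) ≡ x
  at-∷ʳ-length []      x = refl
  at-∷ʳ-length (y ∷ w) x = at-∷ʳ-length w x

  colours : List (Fin (suc a))
  colours = List.allFin (suc a)

  colourings : ℕ → List Colouring
  colourings zero    = [ [] ]
  colourings (suc m) = concatMap (λ w → map (w ∷ʳ_) colours) (colourings m)

  colourings-length : ∀ m → All (λ w → length w ≡ m) (colourings m)
  colourings-length zero    = refl ∷ []
  colourings-length (suc m) = All.concat⁺ (All.map⁺ (All.map extend (colourings-length m)))
    where
    extend : ∀ {w} → length w ≡ m → All (λ w′ → length w′ ≡ suc m) (map (w ∷ʳ_) colours)
    extend {w} refl = All.map⁺ (All.universal (λ x → trans (length-++ w) (ℕ.+-comm (length w) 1)) colours)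

  length-filter-≡-colours : ∀ c → length (filter (_≟ c) colours) ≡ 1
  length-filter-≡-colours c = trans
    (length-filter-except (_≟ c) (λ _ → no λ ()) (λ x≢c x≡c → x≢c x≡c) (λ _ ()) refl (λ ())
      (Unique.allFin⁺ (suc a)) (∈-allFin c))
    (cong (suc ∘ length) (filter-none (λ _ → no λ ()) (All.universal (λ _ ()) colours)))

  module _ {n : ℕ} (ρ : Fin n → ℕ) (ρ≤ : ∀ i → ρ i ≤ toℕ i) where

    Respects : ℕ → Colouring → Set
    Respects m w = ∀ i → toℕ i < m → at w (toℕ i) ≡ at w (ρ i)

    respects? : ∀ m w → Dec (Respects m w)
    respects? m w = all? (λ i → (toℕ i ℕ.<? m) →-dec (at w (toℕ i) ≟ at w (ρ i)))

    roots : ℕ → ℕ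
    roots m = length (filter (λ i → (toℕ i ℕ.<? m) ×-dec (ρ i ℕ.≟ toℕ i)) (List.allFin n))

    module Extend {m : ℕ} (m<n : m < n) where

      new : Fin n
      new = Fin.fromℕ< m<n

      toℕ-new : toℕ new ≡ m
      toℕ-new = Fin.toℕ-fromℕ< m<n

      below-new : ∀ {i} → toℕ i < suc m → i ≢ new → toℕ i < m
      below-new {i} i<1+m i≢new with ℕ.m<1+n⇒m<n∨m≡n i<1+m
      ... | inj₁ i<m = i<m
      ... | inj₂ i≡m = ⊥-elim (i≢new (toℕ-injective (trans i≡m (sym toℕ-new))))

      -- A new position is a root iff ρ does not point back into the old ones.
      factor : Dec (ρ new ≡ m) → ℕ
      factor (yes _) = suc a
      factor (no _)  = 1

      roots-suc : suc a ℕ.^ roots (suc m) ≡ factor (ρ new ℕ.≟ m) * suc a ℕ.^ roots m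
      roots-suc with ρ new ℕ.≟ m
      ... | yes ρ≡m = cong (suc a ℕ.^_) (length-filter-except _ _
          (λ i≢new (i<1+m , root) → below-new i<1+m i≢new , root) (λ _ (i<m , root) → ℕ.m<n⇒m<1+n i<m , root)
          (subst (_< suc m) (sym toℕ-new) ≤-refl , trans ρ≡m (sym toℕ-new))
          (λ (new<m , _) → ℕ.<-irrefl toℕ-new new<m)
          (Unique.allFin⁺ n) (∈-allFin new))
      ... | no ρ≢m = trans (cong (suc a ℕ.^_) (cong length (filter-≐ _ _
          ((λ (i<1+m , root) → below-new i<1+m (λ { refl → ρ≢m (trans root toℕ-new) }) , root) ,
           (λ (i<m , root) → ℕ.m<n⇒m<1+n i<m , root)) (List.allFin n))))
          (sym (ℕ.*-identityˡ _))

      respects-init : ∀ {w x} → length w ≡ m → Respects (suc m) (w ∷ʳ x) → Respects m w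
      respects-init {w} {x} refl r i i<m = begin
        at w (toℕ i)         ≡⟨ at-∷ʳ-< w x i<m ⟨
        at (w ∷ʳ x) (toℕ i)  ≡⟨ r i (ℕ.m<n⇒m<1+n i<m) ⟩
        at (w ∷ʳ x) (ρ i)    ≡⟨ at-∷ʳ-< w x (ℕ.≤-<-trans (ρ≤ i) i<m) ⟩
        at w (ρ i)           ∎
        where open ≡-Reasoning

      respects-last : ∀ {w x} → length w ≡ m → Respects (suc m) (w ∷ʳ x) → x ≡ at (w ∷ʳ x) (ρ new)
      respects-last {w} {x} refl r = begin
        x                       ≡⟨ at-∷ʳ-length w x ⟨
        at (w ∷ʳ x) (length w)  ≡⟨ cong (at (w ∷ʳ x)) toℕ-new ⟨
        at (w ∷ʳ x) (toℕ new)   ≡⟨ r new (subst (_< suc m) (sym toℕ-new) ≤-refl) ⟩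
        at (w ∷ʳ x) (ρ new)     ∎
        where open ≡-Reasoning

      respects-∷ʳ : ∀ {w x} → length w ≡ m → Respects m w → x ≡ at (w ∷ʳ x) (ρ new) →
                    Respects (suc m) (w ∷ʳ x)
      respects-∷ʳ {w} {x} refl r last i i<1+m with i ≟ new
      ... | yes refl = trans (cong (at (w ∷ʳ x)) toℕ-new) (trans (at-∷ʳ-length w x) last)
      ... | no i≢new = trans (at-∷ʳ-< w x i<m) (trans (r i i<m) (sym (at-∷ʳ-< w x (ℕ.≤-<-trans (ρ≤ i) i<m))))
        where i<m = below-new i<1+m i≢new

      extensions-count : ∀ {w} → length w ≡ m →
                         length (filter (respects? (suc m)) (map (w ∷ʳ_) colours)) ≡
                         (if does (respects? m w) then factor (ρ new ℕ.≟ m) else 0)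
      extensions-count {w} lw =
        trans (length-filter-map (respects? (suc m)) (w ∷ʳ_) colours) (count (respects? m w) (ρ new ℕ.≟ m))
        where
        extension? = respects? (suc m) ∘ (w ∷ʳ_)

        count : (r : Dec (Respects m w)) (d : Dec (ρ new ≡ m)) →
                length (filter extension? colours) ≡ (if does r then factor d else 0)
        count (no ¬r) _ =
          cong length (filter-none extension? (All.universal (λ _ r′ → ¬r (respects-init {w} lw r′)) colours))
        count (yes r) (yes ρ≡m) =
          trans (cong length (filter-all extension? (All.universal (λ x → respects-∷ʳ {w} lw r (sym (last-free x))) colours)))
                (length-tabulate (λ x → x))
          where
          last-free : ∀ x → at (w ∷ʳ x) (ρ new) ≡ x
          last-free x = trans (cong (at (w ∷ʳ x)) (trans ρ≡m (sym lw))) (at-∷ʳ-length w x)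
        count (yes r) (no ρ≢m) =
          trans (cong length (filter-≐ extension? (_≟ c) (to , from) colours)) (length-filter-≡-colours c)
          where
          c = at w (ρ new)
          ρ<length : ρ new < length w
          ρ<length = subst (ρ new <_) (sym lw) (ℕ.≤∧≢⇒< (subst (ρ new ≤_) toℕ-new (ρ≤ new)) ρ≢m)
          to : ∀ {x} → Respects (suc m) (w ∷ʳ x) → x ≡ c
          to {x} r′ = trans (respects-last {w} lw r′) (at-∷ʳ-< w x ρ<length)
          from : ∀ {x} → x ≡ c → Respects (suc m) (w ∷ʳ x)
          from {x} x≡c = respects-∷ʳ {w} lw r (trans x≡c (sym (at-∷ʳ-< w x ρ<length)))

    -- Colour positions 0, 1, …, m−1 in turn: a root is free, any other position copies an earlier one.
    count-respects : ∀ m → m ≤ n → length (filter (respects? m) (colourings m)) ≡ suc a ℕ.^ roots m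
    count-respects zero _ = trans (cong length (filter-all (respects? 0) ((λ _ ()) ∷ [])))
      (cong (suc a ℕ.^_) (sym (cong length (filter-none _ (All.universal no-roots (List.allFin n))))))
      where
      no-roots : ∀ i → ¬ (toℕ i < 0 × ρ i ≡ toℕ i)
      no-roots _ (i<0 , _) = ℕ.n≮0 i<0
    count-respects (suc m) m<n = begin
      length (filter (respects? (suc m)) (colourings (suc m)))
        ≡⟨ length-filter-concatMap (respects? (suc m)) _ (All.map extensions-count (colourings-length m)) ⟩
      sum (map (λ w → if does (respects? m w) then f else 0) (colourings m))
        ≡⟨ sum-indicator (respects? m) f (colourings m) ⟩
      length (filter (respects? m) (colourings m)) * f
        ≡⟨ cong (_* f) (count-respects m (<⇒≤ m<n)) ⟩
      suc a ℕ.^ roots m * f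
        ≡⟨ ℕ.*-comm (suc a ℕ.^ roots m) f ⟩
      f * suc a ℕ.^ roots m
        ≡⟨ roots-suc ⟨
      suc a ℕ.^ roots (suc m) ∎
      where
      open Extend m<n
      open ≡-Reasoning
      f = factor (ρ new ℕ.≟ m)

  Fixes : ∀ {n} → Map n → Colouring → Set
  Fixes g w = ∀ i → at w (toℕ (lookup g i)) ≡ at w (toℕ i)

  fixes? : ∀ {n} (g : Map n) w → Dec (Fixes g w)
  fixes? g w = all? (λ i → at w (toℕ (lookup g i)) ≟ at w (toℕ i))

  fixes-iter : ∀ {n} (g : Map n) w → Fixes g w → ∀ k i → at w (toℕ (iter g k i)) ≡ at w (toℕ i)
  fixes-iter g w fix zero    i = refl
  fixes-iter g w fix (suc k) i = trans (fix _) (fixes-iter g w fix k i)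

  -- A colouring is fixed by g iff it is constant on cycles, i.e. copies each point's colour from its cycle minimum.
  count-fixes : ∀ {n} {g : Map n} → IsPerm g → length (filter (fixes? g) (colourings n)) ≡ suc a ℕ.^ cycles g
  count-fixes {n} {g} pg = begin
    length (filter (fixes? g) (colourings n))
      ≡⟨ cong length (filter-≐ (fixes? g) (respects? ρ ρ≤ n) fixes≐respects (colourings n)) ⟩
    length (filter (respects? ρ ρ≤ n) (colourings n))
      ≡⟨ count-respects ρ ρ≤ n ≤-refl ⟩
    suc a ℕ.^ roots ρ ρ≤ n
      ≡⟨ cong (suc a ℕ.^_) roots≡cycles ⟩
    suc a ℕ.^ cycles g
      ∎
    where
    open ≡-Reasoning
    ρ = orbitMin g
    ρ≤ = orbitMin-≤ g

    fixes⇒respects : ∀ {w} → Fixes g w → Respects ρ ρ≤ n w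
    fixes⇒respects {w} fix i _ with orbitMin-attained g i
    ... | _ , (k , refl) , eq = trans (sym (fixes-iter g w fix k i)) (cong (at w) (sym eq))

    respects⇒fixes : ∀ {w} → Respects ρ ρ≤ n w → Fixes g w
    respects⇒fixes {w} r i = begin
      at w (toℕ (lookup g i))  ≡⟨ r (lookup g i) (toℕ<n _) ⟩
      at w (ρ (lookup g i))    ≡⟨ cong (at w) (orbitMin-reach pg reach-step) ⟨
      at w (ρ i)               ≡⟨ r i (toℕ<n i) ⟨
      at w (toℕ i)             ∎

    fixes≐respects : Fixes g ≐ Respects ρ ρ≤ n
    fixes≐respects = (λ {w} → fixes⇒respects {w}) , (λ {w} → respects⇒fixes {w})

    roots≡cycles : roots ρ ρ≤ n ≡ cycles g
    roots≡cycles = cong length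
      (filter-≐ _ _ ((λ {i} (_ , root) → sym root) , (λ {i} min → toℕ<n i , sym min)) (List.allFin n))

-- Stabilisers and signed fixer sums

module _ {n : ℕ} (G : PermGroup n) where

  elem-isPerm : ∀ {g} → g ∈ elems G → IsPerm g
  elem-isPerm g∈G = isPerm (bij G g∈G)

  ∘ₚ-left-↭ : ∀ {h} → h ∈ elems G → map (h ∘ₚ_) (elems G) ↭ elems G
  ∘ₚ-left-↭ {h} h∈G = ∼bag⇒↭ (unique∧set⇒bag (Unique.map⁺ cancel (unique G)) (unique G) (mk⇔ to from))
    where
    cancel : ∀ {g₁ g₂} → h ∘ₚ g₁ ≡ h ∘ₚ g₂ → g₁ ≡ g₂
    cancel {g₁} {g₂} eq = lookup-ext λ i → injective (elem-isPerm h∈G) _ _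
      (trans (sym (lookup-∘ₚ h g₁ i)) (trans (cong (λ g → lookup g i) eq) (lookup-∘ₚ h g₂ i)))

    to : ∀ {g} → g ∈ map (h ∘ₚ_) (elems G) → g ∈ elems G
    to g∈hG with ∈-map⁻ (h ∘ₚ_) g∈hG
    ... | g′ , g′∈G , refl = comp∈ G h∈G g′∈G

    from : ∀ {g} → g ∈ elems G → g ∈ map (h ∘ₚ_) (elems G)
    from {g} g∈G with inv∈ G h∈G
    ... | h′ , h′∈G , hh′≡id =
      subst (_∈ map (h ∘ₚ_) (elems G)) hh′g≡g (∈-map⁺ (h ∘ₚ_) (comp∈ G h′∈G g∈G))
      where
      hh′g≡g : h ∘ₚ (h′ ∘ₚ g) ≡ g
      hh′g≡g = trans (sym (∘ₚ-assoc h h′ g)) (trans (cong (_∘ₚ g) hh′≡id) (∘ₚ-identityˡ g))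

module _ (a : ℕ) {n : ℕ} (G : PermGroup n) where

  signedFixers : Colouring a → ℤ
  signedFixers w = ∑ (elems G) (λ g → if does (fixes? a g w) then sign g else 0ℤ)

  OddFixer : Colouring a → Map n → Set
  OddFixer w h = Fixes a h w × sign h ≡ -1ℤ

  signedFixers-odd : ∀ {w} → Any (OddFixer w) (elems G) → signedFixers w ≡ 0ℤ
  signedFixers-odd {w} odd with find odd
  ... | h , h∈G , h-fixes , h-odd = x≡-x⇒x≡0 (begin
    ∑ (elems G) term                     ≡⟨ ∑-↭ term (↭-sym (∘ₚ-left-↭ G h∈G)) ⟩
    ∑ (map (h ∘ₚ_) (elems G)) term       ≡⟨ ∑-map (h ∘ₚ_) term (elems G) ⟩
    ∑ (elems G) (term ∘ (h ∘ₚ_))         ≡⟨ ∑-cong (elems G) (term-flip ∘ elem-isPerm G) ⟩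
    ∑ (elems G) (-_ ∘ term)              ≡⟨ ∑-hom -_ refl ℤ.neg-distrib-+ (elems G) term ⟨
    - ∑ (elems G) term                   ∎)
    where
    open ≡-Reasoning
    term : Map n → ℤ
    term g = if does (fixes? a g w) then sign g else 0ℤ

    fixes-h∘ : ∀ g i → at a w (toℕ (lookup (h ∘ₚ g) i)) ≡ at a w (toℕ (lookup g i))
    fixes-h∘ g i = trans (cong (at a w ∘ toℕ) (lookup-∘ₚ h g i)) (h-fixes (lookup g i))

    term-flip : ∀ {g} → IsPerm g → term (h ∘ₚ g) ≡ - term g
    term-flip {g} pg = flip (fixes? a (h ∘ₚ g) w) (fixes? a g w)
      where
      flip : (hg? : Dec (Fixes a (h ∘ₚ g) w)) (g? : Dec (Fixes a g w)) →
             (if does hg? then sign (h ∘ₚ g) else 0ℤ) ≡ - (if does g? then sign g else 0ℤ)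
      flip (yes _)   (yes _)   =
        trans (sign-∘ₚ (elem-isPerm G h∈G) pg) (trans (cong (ℤ._* sign g) h-odd) (-1*i≡-i (sign g)))
      flip (no _)    (no _)    = refl
      flip (yes hg)  (no ¬g)   = ⊥-elim (¬g λ i → trans (sym (fixes-h∘ g i)) (hg i))
      flip (no ¬hg)  (yes fix) = ⊥-elim (¬hg λ i → trans (fixes-h∘ g i) (fix i))

  private
    oddFixer? : ∀ w → Dec (Any (OddFixer w) (elems G))
    oddFixer? w = any? (λ h → fixes? a h w ×-dec (sign h ℤ.≟ -1ℤ)) (elems G)

  signedFixers-even : ∀ {w} → ¬ Any (OddFixer w) (elems G) →
                      signedFixers w ≡ + length (filter (λ g → fixes? a g w) (elems G))
  signedFixers-even {w} ¬odd = begin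
    signedFixers w
      ≡⟨ ∑-cong (elems G) even-term ⟩
    ∑ (elems G) (λ g → if does (fixes? a g w) then 1ℤ else 0ℤ)
      ≡⟨ ∑-indicator (λ g → fixes? a g w) 1ℤ (elems G) ⟨
    1ℤ ℤ.* + length (filter (λ g → fixes? a g w) (elems G))
      ≡⟨ ℤ.*-identityˡ _ ⟩
    + length (filter (λ g → fixes? a g w) (elems G))
      ∎
    where
    open ≡-Reasoning
    even-term : ∀ {g} → g ∈ elems G →
                (if does (fixes? a g w) then sign g else 0ℤ) ≡ (if does (fixes? a g w) then 1ℤ else 0ℤ)
    even-term {g} g∈G = even (fixes? a g w)
      where
      even : (g? : Dec (Fixes a g w)) → (if does g? then sign g else 0ℤ) ≡ (if does g? then 1ℤ else 0ℤ)
      even (no _)    = refl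
      even (yes fix) = case sign-±1 g of λ
        { (inj₁ sign≡1)  → sign≡1
        ; (inj₂ sign≡-1) → ⊥-elim (¬odd (lose g∈G (fix , sign≡-1)))
        }

  signedFixers-nonNegative : ∀ w → signedFixers w ≡ + ℤ.∣ signedFixers w ∣
  signedFixers-nonNegative w with oddFixer? w
  ... | yes odd = trans z (cong (+_ ∘ ℤ.∣_∣) (sym z)) where z = signedFixers-odd {w} odd
  ... | no ¬odd = trans p (cong (+_ ∘ ℤ.∣_∣) (sym p)) where p = signedFixers-even {w} ¬odd

  -- Otherwise the sum counts the fixers of w, among them the identity.
  signedFixers-≡0 : ∀ w → signedFixers w ≡ 0ℤ → Any (OddFixer w) (elems G)
  signedFixers-≡0 w eq with oddFixer? w
  ... | yes odd = odd
  ... | no ¬odd = ⊥-elim (ℕ.<⇒≢ (filter-some (λ g → fixes? a g w) (lose (id∈ G) fixes-id)) (sym no-fixers))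
    where
    no-fixers : length (filter (λ g → fixes? a g w) (elems G)) ≡ 0
    no-fixers = ℤ.+-injective (trans (sym (signedFixers-even {w} ¬odd)) eq)

    fixes-id : Fixes a idₚ w
    fixes-id i = cong (at a w ∘ toℕ) (lookup-idₚ i)

F[-a]≡signedFixers : ∀ a {n} (G : PermGroup n) →
                     F G (- (+ suc a)) ≡ -1ℤ ^ cycles (idₚ {n}) ℤ.* ∑ (colourings a n) (signedFixers a G)
F[-a]≡signedFixers a {n} G = begin
  F G (- (+ suc a))
    ≡⟨ ∑-cong es (λ {g} _ → [-a]^cycles g) ⟩
  ∑ es (λ g → ε ℤ.* (sign g ℤ.* + (suc a ℕ.^ cycles g)))
    ≡⟨ ∑-hom (ℤ._*_ ε) (ℤ.*-zeroʳ ε) (ℤ.*-distribˡ-+ ε) es _ ⟨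
  ε ℤ.* ∑ es (λ g → sign g ℤ.* + (suc a ℕ.^ cycles g))
    ≡⟨ cong (ℤ._*_ ε) (∑-cong es (λ {g} g∈G → cong (λ k → sign g ℤ.* + k) (count-fixes a (elem-isPerm G g∈G)))) ⟨
  ε ℤ.* ∑ es (λ g → sign g ℤ.* + length (filter (fixes? a g) ws))
    ≡⟨ cong (ℤ._*_ ε) (∑-cong es (λ {g} _ → ∑-indicator (fixes? a g) (sign g) ws)) ⟩
  ε ℤ.* ∑ es (λ g → ∑ ws (λ w → if does (fixes? a g w) then sign g else 0ℤ))
    ≡⟨ cong (ℤ._*_ ε) (∑-swap es ws _) ⟩
  ε ℤ.* ∑ ws (signedFixers a G)
    ∎
  where
  open ≡-Reasoning
  es = elems G
  ws = colourings a n
  ε = -1ℤ ^ cycles (idₚ {n})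

  [-a]^cycles : ∀ g → (- (+ suc a)) ^ cycles g ≡ ε ℤ.* (sign g ℤ.* + (suc a ℕ.^ cycles g))
  [-a]^cycles g = begin
    (- (+ suc a)) ^ cycles g
      ≡⟨ [-a]^k≡-1^k*a^k (suc a) (cycles g) ⟩
    -1ℤ ^ cycles g ℤ.* + (suc a ℕ.^ cycles g)
      ≡⟨ cong (ℤ._* + (suc a ℕ.^ cycles g)) (-1^cycles≡-1^cycles[id]*sign g) ⟩
    (ε ℤ.* sign g) ℤ.* + (suc a ℕ.^ cycles g)
      ≡⟨ ℤ.*-assoc ε (sign g) _ ⟩
    ε ℤ.* (sign g ℤ.* + (suc a ℕ.^ cycles g))
      ∎

F[-a]≡0⇒oddFixer : ∀ a {n} (G : PermGroup n) → F G (- (+ suc a)) ≡ 0ℤ →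
                   ∀ {w} → w ∈ colourings a n → Any (OddFixer a G w) (elems G)
F[-a]≡0⇒oddFixer a {n} G F≡0 {w} w∈ws = signedFixers-≡0 a G w
  (∑-nonNegative-≡0 (colourings a n) (signedFixers-nonNegative a G)
    (-1^-cancel (cycles (idₚ {n})) (trans (sym (F[-a]≡signedFixers a G)) F≡0)) w∈ws)

mainTheorem8 : (n : ℕ) (G₁ G₂ : PermGroup n) → G₁ ≤G G₂ →
                 (a : ℕ) → 1 ≤ a → F G₁ (- (+ a)) ≡ 0ℤ → F G₂ (- (+ a)) ≡ 0ℤ
mainTheorem8 n G₁ G₂ G₁≤G₂ (suc a) _ F₁≡0 = begin
  F G₂ (- (+ suc a))              ≡⟨ F[-a]≡signedFixers a G₂ ⟩
  ε ℤ.* ∑ ws (signedFixers a G₂)  ≡⟨ cong (ℤ._*_ ε) (trans (∑-cong ws vanishes) (∑-zero ws)) ⟩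
  ε ℤ.* 0ℤ                        ≡⟨ ℤ.*-zeroʳ ε ⟩
  0ℤ                              ∎
  where
  open ≡-Reasoning
  ws = colourings a n
  ε = -1ℤ ^ cycles (idₚ {n})

  vanishes : ∀ {w} → w ∈ ws → signedFixers a G₂ w ≡ 0ℤ
  vanishes {w} w∈ws = signedFixers-odd a G₂ {w} (Any-resp-⊆ G₁≤G₂ (F[-a]≡0⇒oddFixer a G₁ F₁≡0 w∈ws))
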